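{- In each of the logics IPL (intuitionistic propositional logic), S4.3 and GL (Gödel–Löb provability logic), for every formula $\psi$ there are formulas $\delta^\psi_\top$ and $\delta^\psi_\bot$ such that $t(\delta^\psi_\top)\approx t(\psi)$ and $\vdash\top\leftrightarrow\delta^\psi_\top$, and $t(\delta^\psi_\bot)\approx t(\psi)$ and $\vdash\bot\leftrightarrow\delta^\psi_\bot$.
   Context: The formulas of IPL are built from schema variables $\xi_0,\xi_1,\dots$ and the constants $\top,\bot$ using $\neg$ (unary) and $\wedge,\vee,\to,\leftrightarrow$ (binary); for S4.3 and GL one additionally has the unary modality $\Box$. $\vdash$ is theoremhood in the respective logic (IPL: intuitionistic propositional logic; S4.3: normal modal logic of reflexive, transitive, connected frames; GL: normal modal logic of transitive, irreflexive, finite frames). The decomposition tree $t(\varphi)$ is the rooted tree whose vertices are the subformula occurrences of $\varphi$, with an edge from $c(\varphi_1,\dots,\varphi_m)$ to each $\varphi_i$. An embedding of a tree $t_1$ into a tree $t_2$ is a pair of injective maps $h_v$ on vertices and $h_e$ on edges such that for every edge $e$ of $t_1$, $h_v(\mathrm{source}(e))=\mathrm{source}(h_e(e))$, $h_v(\mathrm{target}(e))=\mathrm{target}(h_e(e))$, and $\mathrm{source}(e)$ and $\mathrm{source}(h_e(e))$ have the same outdegree. $t(\varphi_1)\approx t(\varphi_2)$ means each tree embeds into the other. -}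

module Defs where

open import Data.Nat using (ℕ)
open import Data.Fin using (Fin)
open import Data.List using (List; []; _∷_; length; lookup)
open import Data.Product using (Σ; _×_; _,_; proj₁)
open import Data.Unit using () renaming (⊤ to Unit)
open import Relation.Binary.PropositionalEquality using (_≡_)
open import Function.Definitions using (Injective)

infixr 6 _∧_
infixr 5 _∨_
infixr 4 _⇒_
infix  3 _⇔_
infix  7 ¬ᶠ_ □_
infix  1 _⊢_

data Fm : Set where
  var       : ℕ → Fm
  ⊤ᶠ ⊥ᶠ     : Fm
  ¬ᶠ_ □_    : Fm → Fm
  _∧_ _∨_ _⇒_ _⇔_ : Fm → Fm → Fm

children : Fm → List Fm
children (var _) = []
children ⊤ᶠ = []
children ⊥ᶠ = []
children (¬ᶠ φ) = φ ∷ []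
children (□ φ) = φ ∷ []
children (φ ∧ ψ) = φ ∷ ψ ∷ []
children (φ ∨ ψ) = φ ∷ ψ ∷ []
children (φ ⇒ ψ) = φ ∷ ψ ∷ []
children (φ ⇔ ψ) = φ ∷ ψ ∷ []

BoxFree : Fm → Set
BoxFree (var _) = Unit
BoxFree ⊤ᶠ = Unit
BoxFree ⊥ᶠ = Unit
BoxFree (¬ᶠ φ) = BoxFree φ
BoxFree (□ φ) = Data.Empty.⊥ where import Data.Empty
BoxFree (φ ∧ ψ) = BoxFree φ × BoxFree ψ
BoxFree (φ ∨ ψ) = BoxFree φ × BoxFree ψ
BoxFree (φ ⇒ ψ) = BoxFree φ × BoxFree ψ
BoxFree (φ ⇔ ψ) = BoxFree φ × BoxFree ψ

-- Decomposition tree t(φ).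
-- Vertices = subformula occurrences = positions (paths from the root).

data Pos : Fm → Set where
  here : ∀ {φ} → Pos φ
  down : ∀ {φ} (i : Fin (length (children φ))) →
         Pos (lookup (children φ) i) → Pos φ

subAt : ∀ {φ} → Pos φ → Fm
subAt {φ} here = φ
subAt (down i p) = subAt p

outdeg : ∀ {φ} → Pos φ → ℕ
outdeg p = length (children (subAt p))

Edge : Fm → Set
Edge φ = Σ (Pos φ) (λ p → Fin (outdeg p))

source : ∀ {φ} → Edge φ → Pos φ
source (p , _) = p

childPos : ∀ {φ} (p : Pos φ) → Fin (outdeg p) → Pos φ
childPos here i = down i here
childPos (down j p) i = down j (childPos p i)

target : ∀ {φ} → Edge φ → Pos φ
target (p , i) = childPos p i

record Embeds (φ ψ : Fm) : Set where
  field
    hv     : Pos φ → Pos ψ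
    he     : Edge φ → Edge ψ
    hv-inj : Injective _≡_ _≡_ hv
    he-inj : Injective _≡_ _≡_ he
    src    : ∀ e → hv (source e) ≡ source (he e)
    tgt    : ∀ e → hv (target e) ≡ target (he e)
    deg    : ∀ e → outdeg (source e) ≡ outdeg (source (he e))

_≈t_ : Fm → Fm → Set
φ ≈t ψ = Embeds φ ψ × Embeds ψ φ

data IntAx : Fm → Set where
  k    : ∀ A B → IntAx (A ⇒ B ⇒ A)
  s    : ∀ A B C → IntAx ((A ⇒ B ⇒ C) ⇒ (A ⇒ B) ⇒ A ⇒ C)
  ∧e₁  : ∀ A B → IntAx (A ∧ B ⇒ A)
  ∧e₂  : ∀ A B → IntAx (A ∧ B ⇒ B)
  ∧i   : ∀ A B → IntAx (A ⇒ B ⇒ A ∧ B)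
  ∨i₁  : ∀ A B → IntAx (A ⇒ A ∨ B)
  ∨i₂  : ∀ A B → IntAx (B ⇒ A ∨ B)
  ∨e   : ∀ A B C → IntAx ((A ⇒ C) ⇒ (B ⇒ C) ⇒ A ∨ B ⇒ C)
  ⊥e   : ∀ A → IntAx (⊥ᶠ ⇒ A)
  ⊤i   : IntAx ⊤ᶠ
  ¬e   : ∀ A → IntAx (¬ᶠ A ⇒ A ⇒ ⊥ᶠ)
  ¬i   : ∀ A → IntAx ((A ⇒ ⊥ᶠ) ⇒ ¬ᶠ A)
  ⇔e₁  : ∀ A B → IntAx ((A ⇔ B) ⇒ A ⇒ B)
  ⇔e₂  : ∀ A B → IntAx ((A ⇔ B) ⇒ B ⇒ A)
  ⇔i   : ∀ A B → IntAx ((A ⇒ B) ⇒ (B ⇒ A) ⇒ (A ⇔ B))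

data Logic : Set where
  IPL S4∙3 GL : Logic

InLang : Logic → Fm → Set
InLang IPL φ = BoxFree φ
InLang S4∙3 φ = Unit
InLang GL φ = Unit

data Axiom : Logic → Fm → Set where
  int   : ∀ {L A} → IntAx A → Axiom L A
  dne   : ∀ {A} → Axiom S4∙3 (¬ᶠ ¬ᶠ A ⇒ A)
  dneGL : ∀ {A} → Axiom GL (¬ᶠ ¬ᶠ A ⇒ A)
  K     : ∀ {A B} → Axiom S4∙3 (□ (A ⇒ B) ⇒ □ A ⇒ □ B)
  KGL   : ∀ {A B} → Axiom GL (□ (A ⇒ B) ⇒ □ A ⇒ □ B)
  T     : ∀ {A} → Axiom S4∙3 (□ A ⇒ A)
  Four  : ∀ {A} → Axiom S4∙3 (□ A ⇒ □ □ A)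
  Dot3  : ∀ {A B} → Axiom S4∙3 (□ (□ A ⇒ B) ∨ □ (□ B ⇒ A))
  Löb   : ∀ {A} → Axiom GL (□ (□ A ⇒ A) ⇒ □ A)

data _⊢_ : Logic → Fm → Set where
  ax    : ∀ {L A} → Axiom L A → L ⊢ A
  mp    : ∀ {L A B} → L ⊢ (A ⇒ B) → L ⊢ A → L ⊢ B
  nec   : ∀ {A} → S4∙3 ⊢ A → S4∙3 ⊢ □ A
  necGL : ∀ {A} → GL ⊢ A → GL ⊢ □ A

-- Replace every leaf of ψ by the constant ⊤ (resp. ⊥), every binary
-- connective by ∧, and every ¬ or □ by ¬ while switching the target
-- constant.  The result has the same decomposition tree as ψ up to
-- relabelling, and it is intuitionistically provable (resp. refutable), by
-- induction: ⊤ ∧ ⊤ and ¬⊥ are provable, ⊥ ∧ ⊥ and ¬⊤ refutable.  The formula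
-- is □-free, so this works uniformly in IPL, S4.3 and GL.
module Submission where

open import Defs
open import Data.Bool using (Bool; true; false; not)
open import Data.Fin using (Fin; cast)
open import Data.Fin.Properties using (cast-involutive)
open import Data.List using (length; lookup)
open import Data.List.Relation.Binary.Pointwise using (Pointwise; []; _∷_; lookup⁺; Pointwise-length)
open import Data.Product using (Σ; _×_; _,_; proj₁)
open import Data.Product.Properties.WithK using (,-injectiveʳ)
open import Data.Unit using (tt)
open import Function.Definitions using (Injective)
open import Relation.Binary.PropositionalEquality using (_≡_; refl; sym; trans; cong)

cast-injective : ∀ {m n} (eq : m ≡ n) → Injective _≡_ _≡_ (cast eq)
cast-injective eq {i} {j} h =
  trans (sym (cast-involutive (sym eq) eq i))
        (trans (cong (cast (sym eq)) h) (cast-involutive (sym eq) eq j))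

data SameShape : Fm → Fm → Set where
  sameShape : ∀ {φ ψ} → Pointwise SameShape (children φ) (children ψ) → SameShape φ ψ

SameShape-sym : ∀ {φ ψ} → SameShape φ ψ → SameShape ψ φ
SameShape-sym (sameShape cs) = sameShape (pointwise-sym cs)
  where
  pointwise-sym : ∀ {xs ys} → Pointwise SameShape xs ys → Pointwise SameShape ys xs
  pointwise-sym [] = []
  pointwise-sym (σ ∷ σs) = SameShape-sym σ ∷ pointwise-sym σs

module _ {φ ψ : Fm} where

  childIndex : SameShape φ ψ → Fin (length (children φ)) → Fin (length (children ψ))
  childIndex (sameShape cs) = cast (Pointwise-length cs)

  childIndex-injective : (σ : SameShape φ ψ) → Injective _≡_ _≡_ (childIndex σ)
  childIndex-injective (sameShape cs) = cast-injective (Pointwise-length cs)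

  length-children-≡ : (σ : SameShape φ ψ) → length (children φ) ≡ length (children ψ)
  length-children-≡ (sameShape cs) = Pointwise-length cs

  childShape : (σ : SameShape φ ψ) (i : Fin (length (children φ))) →
               SameShape (lookup (children φ) i) (lookup (children ψ) (childIndex σ i))
  childShape (sameShape cs) = lookup⁺ cs

down-injectiveˡ : ∀ {φ i j} {p : Pos (lookup (children φ) i)} {q : Pos (lookup (children φ) j)} →
                  Pos.down {φ} i p ≡ down j q → i ≡ j
down-injectiveˡ refl = refl

down-injectiveʳ : ∀ {φ i} {p q : Pos (lookup (children φ) i)} → Pos.down {φ} i p ≡ down i q → p ≡ q
down-injectiveʳ refl = refl

mapPos : ∀ {φ ψ} → SameShape φ ψ → Pos φ → Pos ψ
mapPos σ here = here
mapPos σ (down i p) = down (childIndex σ i) (mapPos (childShape σ i) p)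

subAt-mapPos : ∀ {φ ψ} (σ : SameShape φ ψ) (p : Pos φ) → SameShape (subAt p) (subAt (mapPos σ p))
subAt-mapPos σ here = σ
subAt-mapPos σ (down i p) = subAt-mapPos (childShape σ i) p

mapPos-injective : ∀ {φ ψ} (σ : SameShape φ ψ) → Injective _≡_ _≡_ (mapPos σ)
mapPos-injective σ {here} {here} _ = refl
mapPos-injective σ {here} {down _ _} ()
mapPos-injective σ {down _ _} {here} ()
mapPos-injective σ {down i p} {down j q} eq with childIndex-injective σ (down-injectiveˡ eq)
... | refl = cong (down i) (mapPos-injective (childShape σ i) (down-injectiveʳ eq))

mapEdge : ∀ {φ ψ} → SameShape φ ψ → Edge φ → Edge ψ
mapEdge σ (p , i) = mapPos σ p , childIndex (subAt-mapPos σ p) i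

mapEdge-injective : ∀ {φ ψ} (σ : SameShape φ ψ) → Injective _≡_ _≡_ (mapEdge σ)
mapEdge-injective σ {p , i} {q , j} eq with mapPos-injective σ (cong proj₁ eq)
... | refl with childIndex-injective (subAt-mapPos σ p) (,-injectiveʳ eq)
... | refl = refl

mapPos-childPos : ∀ {φ ψ} (σ : SameShape φ ψ) (p : Pos φ) (i : Fin (outdeg p)) →
                  mapPos σ (childPos p i) ≡ childPos (mapPos σ p) (childIndex (subAt-mapPos σ p) i)
mapPos-childPos σ here i = refl
mapPos-childPos σ (down j p) i = cong (down (childIndex σ j)) (mapPos-childPos (childShape σ j) p i)

SameShape⇒Embeds : ∀ {φ ψ} → SameShape φ ψ → Embeds φ ψ
SameShape⇒Embeds σ = record
  { hv     = mapPos σ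
  ; he     = mapEdge σ
  ; hv-inj = mapPos-injective σ
  ; he-inj = mapEdge-injective σ
  ; src    = λ _ → refl
  ; tgt    = λ { (p , i) → mapPos-childPos σ p i }
  ; deg    = λ { (p , _) → length-children-≡ (subAt-mapPos σ p) }
  }

SameShape⇒≈t : ∀ {φ ψ} → SameShape φ ψ → φ ≈t ψ
SameShape⇒≈t σ = SameShape⇒Embeds σ , SameShape⇒Embeds (SameShape-sym σ)

module _ {L : Logic} where

  axiom : ∀ {A} → IntAx A → L ⊢ A
  axiom a = ax (int a)

  ⇒-refl : ∀ A → L ⊢ (A ⇒ A)
  ⇒-refl A = mp (mp (axiom (s A (A ⇒ A) A)) (axiom (k A (A ⇒ A)))) (axiom (k A A))

  ⇒-weaken : ∀ {A} B → L ⊢ A → L ⊢ (B ⇒ A)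
  ⇒-weaken B a = mp (axiom (k _ B)) a

  mp-under : ∀ {X A B} → L ⊢ (X ⇒ A ⇒ B) → L ⊢ (X ⇒ A) → L ⊢ (X ⇒ B)
  mp-under xab xa = mp (mp (axiom (s _ _ _)) xab) xa

  ⇒-trans : ∀ {A B C} → L ⊢ (A ⇒ B) → L ⊢ (B ⇒ C) → L ⊢ (A ⇒ C)
  ⇒-trans ab bc = mp-under (⇒-weaken _ bc) ab

const : Bool → Fm
const true = ⊤ᶠ
const false = ⊥ᶠ

Decided : Logic → Bool → Fm → Set
Decided L true φ = L ⊢ φ
Decided L false φ = L ⊢ (φ ⇒ ⊥ᶠ)

module _ {L : Logic} where

  const-decided : ∀ b → Decided L b (const b)
  const-decided true = axiom ⊤i
  const-decided false = ⇒-refl ⊥ᶠ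

  ¬-decided : ∀ b {φ} → Decided L (not b) φ → Decided L b (¬ᶠ φ)
  ¬-decided true ⊬φ = mp (axiom (¬i _)) ⊬φ
  ¬-decided false ⊢φ = mp-under (axiom (¬e _)) (⇒-weaken _ ⊢φ)

  ∧-decided : ∀ b {φ χ} → Decided L b φ → Decided L b χ → Decided L b (φ ∧ χ)
  ∧-decided true ⊢φ ⊢χ = mp (mp (axiom (∧i _ _)) ⊢φ) ⊢χ
  ∧-decided false ⊬φ _ = ⇒-trans (axiom (∧e₁ _ _)) ⊬φ

  decided⇒⇔const : ∀ b {φ} → Decided L b φ → L ⊢ (const b ⇔ φ)
  decided⇒⇔const true ⊢φ = mp (mp (axiom (⇔i _ _)) (⇒-weaken _ ⊢φ)) (⇒-weaken _ (axiom ⊤i))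
  decided⇒⇔const false ⊬φ = mp (mp (axiom (⇔i _ _)) (axiom (⊥e _))) ⊬φ

δ : Bool → Fm → Fm
δ b (var _) = const b
δ b ⊤ᶠ = const b
δ b ⊥ᶠ = const b
δ b (¬ᶠ φ) = ¬ᶠ δ (not b) φ
δ b (□ φ) = ¬ᶠ δ (not b) φ
δ b (φ ∧ χ) = δ b φ ∧ δ b χ
δ b (φ ∨ χ) = δ b φ ∧ δ b χ
δ b (φ ⇒ χ) = δ b φ ∧ δ b χ
δ b (φ ⇔ χ) = δ b φ ∧ δ b χ

const-sameShape : ∀ b {φ} → SameShape ⊤ᶠ φ → SameShape (const b) φ
const-sameShape true σ = σ
const-sameShape false (sameShape cs) = sameShape cs

δ-sameShape : ∀ b ψ → SameShape (δ b ψ) ψ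
δ-sameShape b (var _) = const-sameShape b (sameShape [])
δ-sameShape b ⊤ᶠ = const-sameShape b (sameShape [])
δ-sameShape b ⊥ᶠ = const-sameShape b (sameShape [])
δ-sameShape b (¬ᶠ φ) = sameShape (δ-sameShape (not b) φ ∷ [])
δ-sameShape b (□ φ) = sameShape (δ-sameShape (not b) φ ∷ [])
δ-sameShape b (φ ∧ χ) = sameShape (δ-sameShape b φ ∷ δ-sameShape b χ ∷ [])
δ-sameShape b (φ ∨ χ) = sameShape (δ-sameShape b φ ∷ δ-sameShape b χ ∷ [])
δ-sameShape b (φ ⇒ χ) = sameShape (δ-sameShape b φ ∷ δ-sameShape b χ ∷ [])
δ-sameShape b (φ ⇔ χ) = sameShape (δ-sameShape b φ ∷ δ-sameShape b χ ∷ [])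

const-boxFree : ∀ b → BoxFree (const b)
const-boxFree true = tt
const-boxFree false = tt

δ-boxFree : ∀ b ψ → BoxFree (δ b ψ)
δ-boxFree b (var _) = const-boxFree b
δ-boxFree b ⊤ᶠ = const-boxFree b
δ-boxFree b ⊥ᶠ = const-boxFree b
δ-boxFree b (¬ᶠ φ) = δ-boxFree (not b) φ
δ-boxFree b (□ φ) = δ-boxFree (not b) φ
δ-boxFree b (φ ∧ χ) = δ-boxFree b φ , δ-boxFree b χ
δ-boxFree b (φ ∨ χ) = δ-boxFree b φ , δ-boxFree b χ
δ-boxFree b (φ ⇒ χ) = δ-boxFree b φ , δ-boxFree b χ
δ-boxFree b (φ ⇔ χ) = δ-boxFree b φ , δ-boxFree b χ

δ-inLang : ∀ L b ψ → InLang L (δ b ψ)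
δ-inLang IPL b ψ = δ-boxFree b ψ
δ-inLang S4∙3 _ _ = tt
δ-inLang GL _ _ = tt

δ-decided : ∀ {L} b ψ → Decided L b (δ b ψ)
δ-decided b (var _) = const-decided b
δ-decided b ⊤ᶠ = const-decided b
δ-decided b ⊥ᶠ = const-decided b
δ-decided b (¬ᶠ φ) = ¬-decided b (δ-decided (not b) φ)
δ-decided b (□ φ) = ¬-decided b (δ-decided (not b) φ)
δ-decided b (φ ∧ χ) = ∧-decided b (δ-decided b φ) (δ-decided b χ)
δ-decided b (φ ∨ χ) = ∧-decided b (δ-decided b φ) (δ-decided b χ)
δ-decided b (φ ⇒ χ) = ∧-decided b (δ-decided b φ) (δ-decided b χ)
δ-decided b (φ ⇔ χ) = ∧-decided b (δ-decided b φ) (δ-decided b χ)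

δ-spec : ∀ L b ψ → InLang L (δ b ψ) × (δ b ψ ≈t ψ) × (L ⊢ (const b ⇔ δ b ψ))
δ-spec L b ψ = δ-inLang L b ψ , SameShape⇒≈t (δ-sameShape b ψ) , decided⇒⇔const b (δ-decided b ψ)

proposition3p10 : (L : Logic) (ψ : Fm) → InLang L ψ →
      Σ Fm (λ δ⊤ → InLang L δ⊤ × (δ⊤ ≈t ψ) × (L ⊢ (⊤ᶠ ⇔ δ⊤)))
    × Σ Fm (λ δ⊥ → InLang L δ⊥ × (δ⊥ ≈t ψ) × (L ⊢ (⊥ᶠ ⇔ δ⊥)))
proposition3p10 L ψ _ = (δ true ψ , δ-spec L true ψ) , (δ false ψ , δ-spec L false ψ)
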